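{- Let $p$ be a prime, $b\in\mathbb{F}_p$ and $\mathbf{a},\mathbf{d}\in\mathbb{F}_p^n$. Then $\Delta_{\mathbf{d}}\in\mathrm{Sym}(F(\mathbf{a},b))$ if and only if $\mathbf{a}\cdot\mathbf{d}=0$.
   Context: Variables $\xi_{i,k}$ ($i\in[1,n]$, $k\in\mathbb{F}_p$). $\Delta_{\mathbf{d}}$ is the renaming $\xi_{i,k}\mapsto\xi_{i,k+\mathbf{d}_i}$ (extended to literals by $\overline{\xi}\mapsto\overline{\Delta_{\mathbf{d}}(\xi)}$ and to clauses and formulas elementwise). For a CNF formula $F$ (set of clauses), $\mathrm{Sym}(F)$ is the set of renamings $\sigma$ with $\sigma(F)=F$. $\mathrm{supp}(\mathbf{r})=\{i:r_i\neq0\}$; $P(\mathbf{a},b)=\{\mathbf{x}\in\mathbb{F}_p^n:\mathbf{a}\cdot\mathbf{x}\neq b,\ \mathrm{supp}(\mathbf{x})\subseteq\mathrm{supp}(\mathbf{a})\}$; $C_{\mathbf{a}}(\mathbf{x})=\bigvee_{i\in\mathrm{supp}(\mathbf{a})}\overline{\xi_{i,\mathbf{x}_i}}$; $F(\mathbf{a},b)=\bigwedge_{\mathbf{x}\in P(\mathbf{a},b)}C_{\mathbf{a}}(\mathbf{x})$. -}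

module Defs where

open import Level using (0ℓ; Lift)
open import Data.Nat using (ℕ; zero; suc; _+_; _*_; NonZero)
open import Data.Nat.DivMod using (_mod_)
open import Data.Fin using (Fin; toℕ)
open import Data.Fin.Patterns using (0F)
open import Data.Product using (Σ; _×_; _,_; ∃)
open import Relation.Binary.PropositionalEquality using (_≡_)
open import Relation.Nullary using (¬_)

𝔽 : ℕ → Set
𝔽 p = Fin p

module _ (p : ℕ) .{{_ : NonZero p}} where

  _+ₚ_ : 𝔽 p → 𝔽 p → 𝔽 p
  x +ₚ y = (toℕ x + toℕ y) mod p

  zeroₚ : 𝔽 p
  zeroₚ = 0 mod p

sumℕ : (n : ℕ) → (Fin n → ℕ) → ℕ
sumℕ zero    f = 0
sumℕ (suc n) f = f Fin.zero + sumℕ n (λ i → f (Fin.suc i))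
  where import Data.Fin as Fin

dot : (p : ℕ) .{{_ : NonZero p}} {n : ℕ} → (Fin n → 𝔽 p) → (Fin n → 𝔽 p) → 𝔽 p
dot p {n} a x = sumℕ n (λ i → toℕ (a i) * toℕ (x i)) mod p

Vec𝔽 : ℕ → ℕ → Set
Vec𝔽 p n = Fin n → 𝔽 p

_∈supp_ : ∀ {p n} .{{_ : NonZero p}} → Fin n → Vec𝔽 p n → Set
_∈supp_ {p} i r = ¬ (r i ≡ zeroₚ p)

P : (p : ℕ) .{{_ : NonZero p}} {n : ℕ} → Vec𝔽 p n → 𝔽 p → Vec𝔽 p n → Set
P p {n} a b x = ¬ (dot p a x ≡ b) × (∀ (i : Fin n) → i ∈supp x → i ∈supp a)

-- Variables ξ_{i,k}, i ∈ [1,n] (as Fin n), k ∈ F_p.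
Var : ℕ → ℕ → Set
Var p n = Fin n × 𝔽 p

data Lit (p n : ℕ) : Set where
  pos : Var p n → Lit p n
  neg : Var p n → Lit p n

Clause : ℕ → ℕ → Set₁
Clause p n = Lit p n → Set

Formula : ℕ → ℕ → Set₂
Formula p n = Clause p n → Set₁

_≐_ : ∀ {p n} → Clause p n → Clause p n → Set
C ≐ D = ∀ ℓ → (C ℓ → D ℓ) × (D ℓ → C ℓ)

_≐F_ : ∀ {p n} → Formula p n → Formula p n → Set₁
F ≐F G = ∀ C → (F C → G C) × (G C → F C)

Renaming : ℕ → ℕ → Set
Renaming p n = Var p n → Var p n

renLit : ∀ {p n} → Renaming p n → Lit p n → Lit p n
renLit σ (pos v) = pos (σ v)
renLit σ (neg v) = neg (σ v)

renClause : ∀ {p n} → Renaming p n → Clause p n → Clause p n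
renClause σ C ℓ = Σ _ λ ℓ' → C ℓ' × (renLit σ ℓ' ≡ ℓ)

renFormula : ∀ {p n} → Renaming p n → Formula p n → Formula p n
renFormula σ F C = Σ (Clause _ _) λ C' → F C' × (renClause σ C' ≐ C)

_∈Sym_ : ∀ {p n} → Renaming p n → Formula p n → Set₁
σ ∈Sym F = renFormula σ F ≐F F

Δ : (p : ℕ) .{{_ : NonZero p}} {n : ℕ} → Vec𝔽 p n → Renaming p n
Δ p d (i , k) = (i , (_+ₚ_ p k (d i)))

Cl : (p : ℕ) .{{_ : NonZero p}} {n : ℕ} → Vec𝔽 p n → Vec𝔽 p n → Clause p n
Cl p {n} a x ℓ = Σ (Fin n) λ i → (i ∈supp a) × (ℓ ≡ neg (i , x i))

Fab : (p : ℕ) .{{_ : NonZero p}} {n : ℕ} → Vec𝔽 p n → 𝔽 p → Formula p n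
Fab p a b C = Lift _ (Σ (Vec𝔽 p _) λ x → P p a b x × (C ≐ Cl p a x))

{-# OPTIONS --safe #-}
module Submission where

-- Δ_d sends the clause C_a(x) to C_a(x + d), and C_a(x) determines x on supp(a). Shifting by d
-- changes a·x by a·d, so if a·d = 0 then x ↦ x + d (restricted back to supp(a)) maps P(a,b)
-- onto itself and Δ_d permutes the clauses of F(a,b). If c = a·d ≠ 0, pick j with a_j ≠ 0 and
-- x supported at j with a·x = b − c, which is solvable because a_j is invertible modulo the
-- prime p; then C_a(x) is a clause of F(a,b) but its image C_a(x + d) is not, as a·(x + d) = b.

open import Defs
import Level
open import Level using (0ℓ; lift)
open import Algebra.Bundles using (Group)
open import Algebra.Structures using (IsGroup)
import Algebra.Properties.Group as GroupProperties
import Algebra.Properties.CommutativeMonoid.Sum as CommutativeMonoidSum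
open import Data.Nat using (ℕ; zero; suc; _+_; _*_; _∸_; NonZero; ≢-nonZero; >-nonZero⁻¹)
open import Data.Nat.Properties using (*-zeroʳ; +-comm; +-assoc; +-identityʳ; *-assoc; *-comm; *-distribˡ-+; m∸n+n≡m; <⇒≤; +-0-commutativeMonoid)
open import Data.Nat.DivMod using (_%_; _mod_; %-distribˡ-+; %-distribˡ-*; m%n%n≡m%n; m<n⇒m%n≡m; n%n≡0; %-remove-+ʳ)
open import Data.Nat.Divisibility using (_∣_; n∣m*n*o)
open import Data.Nat.Primality using (Prime)
open import Data.Nat.Coprimality using (prime⇒coprime; coprime-Bézout)
open import Data.Nat.GCD using (module Bézout)
open import Data.Fin using (Fin; zero; suc; toℕ; punchIn)
open import Data.Fin.Properties using (toℕ-injective; toℕ-fromℕ<; toℕ<n; punchInᵢ≢i; any?) renaming (_≟_ to _≟ᶠ_)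
open import Data.Vec.Functional using (replicate; zipWith; map; updateAt)
open import Data.Vec.Functional.Properties using (updateAt-updates; updateAt-minimal)
open import Data.Product using (_×_; _,_; proj₁; proj₂; ∃)
open import Function using (_∘_; const; id)
open import Function.Bundles using (_⇔_; mk⇔)
open import Relation.Binary.Bundles using (Setoid)
open import Relation.Binary.Structures using (IsEquivalence)
import Relation.Binary.Reasoning.Setoid as SetoidReasoning
open import Relation.Nullary using (¬_; yes; no; ¬?; contradiction)
open import Relation.Nullary.Decidable using (decidable-stable)
open import Relation.Binary.PropositionalEquality
  using (_≡_; _≢_; refl; sym; trans; cong; cong₂; isEquivalence; module ≡-Reasoning)

open CommutativeMonoidSum +-0-commutativeMonoid
  using (sum; sum-cong-≗; ∑-distrib-+; sum-remove; sum-replicate-zero)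

sumℕ≡sum : ∀ n (f : Fin n → ℕ) → sumℕ n f ≡ sum f
sumℕ≡sum zero    f = refl
sumℕ≡sum (suc n) f = cong (f zero +_) (sumℕ≡sum n (f ∘ suc))

sumℕ-cong : ∀ n {f g : Fin n → ℕ} → (∀ i → f i ≡ g i) → sumℕ n f ≡ sumℕ n g
sumℕ-cong n {f} {g} f≗g = trans (sumℕ≡sum n f) (trans (sum-cong-≗ f≗g) (sym (sumℕ≡sum n g)))

sumℕ-+ : ∀ n (f g : Fin n → ℕ) → sumℕ n (λ i → f i + g i) ≡ sumℕ n f + sumℕ n g
sumℕ-+ n f g = trans (sumℕ≡sum n _) (trans (∑-distrib-+ f g) (sym (cong₂ _+_ (sumℕ≡sum n f) (sumℕ≡sum n g))))

sumℕ-single : ∀ n (f : Fin n → ℕ) j → (∀ i → i ≢ j → f i ≡ 0) → sumℕ n f ≡ f j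
sumℕ-single (suc n) f j off-j = begin
  sumℕ (suc n) f                  ≡⟨ sumℕ≡sum (suc n) f ⟩
  sum f                           ≡⟨ sum-remove f ⟩
  f j + sum (f ∘ punchIn j)       ≡⟨ cong (f j +_) (sum-cong-≗ (λ i → off-j _ (punchInᵢ≢i j i))) ⟩
  f j + sum (replicate n 0)       ≡⟨ cong (f j +_) (sum-replicate-zero n) ⟩
  f j + 0                         ≡⟨ +-identityʳ (f j) ⟩
  f j                             ∎
  where open ≡-Reasoning

module ModularArithmetic (p : ℕ) .{{_ : NonZero p}} where

  infix 8 [_]
  [_] : ℕ → 𝔽 p
  [ m ] = m mod p

  𝟘 : 𝔽 p
  𝟘 = zeroₚ p

  infixl 6 _⊕_
  _⊕_ : 𝔽 p → 𝔽 p → 𝔽 p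
  _⊕_ = _+ₚ_ p

  infix 8 ⊖_
  ⊖_ : 𝔽 p → 𝔽 p
  ⊖ x = [ p ∸ toℕ x ]

  infixl 7 _⊛_
  _⊛_ : 𝔽 p → 𝔽 p → 𝔽 p
  x ⊛ y = [ toℕ x * toℕ y ]

  toℕ-[] : ∀ m → toℕ [ m ] ≡ m % p
  toℕ-[] m = toℕ-fromℕ< _

  toℕ-𝟘 : toℕ 𝟘 ≡ 0
  toℕ-𝟘 = trans (toℕ-[] 0) (m<n⇒m%n≡m (>-nonZero⁻¹ p))

  []-toℕ : ∀ x → [ toℕ x ] ≡ x
  []-toℕ x = toℕ-injective (trans (toℕ-[] (toℕ x)) (m<n⇒m%n≡m (toℕ<n x)))

  %≡%⇒[]≡[] : ∀ {m n} → m % p ≡ n % p → [ m ] ≡ [ n ]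
  %≡%⇒[]≡[] {m} {n} eq = toℕ-injective (trans (toℕ-[] m) (trans eq (sym (toℕ-[] n))))

  []-+ : ∀ m n → [ m + n ] ≡ [ m ] ⊕ [ n ]
  []-+ m n = %≡%⇒[]≡[] (trans (%-distribˡ-+ m n p)
                         (sym (cong₂ (λ u v → (u + v) % p) (toℕ-[] m) (toℕ-[] n))))

  []-*-toℕ : ∀ m n → [ m * toℕ [ n ] ] ≡ [ m * n ]
  []-*-toℕ m n = %≡%⇒[]≡[] (begin
    (m * toℕ [ n ]) % p          ≡⟨ cong (λ k → (m * k) % p) (toℕ-[] n) ⟩
    (m * (n % p)) % p            ≡⟨ %-distribˡ-* m (n % p) p ⟩
    (m % p * (n % p % p)) % p    ≡⟨ cong (λ k → (m % p * k) % p) (m%n%n≡m%n n p) ⟩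
    (m % p * (n % p)) % p        ≡⟨ %-distribˡ-* m n p ⟨
    (m * n) % p                  ∎)
    where open ≡-Reasoning

  []-+-multiple : ∀ m {k} → p ∣ k → [ m + k ] ≡ [ m ]
  []-+-multiple m p∣k = %≡%⇒[]≡[] (%-remove-+ʳ m p∣k)

  []-sumℕ-cong : ∀ n {f g : Fin n → ℕ} → (∀ i → [ f i ] ≡ [ g i ]) → [ sumℕ n f ] ≡ [ sumℕ n g ]
  []-sumℕ-cong zero    _   = refl
  []-sumℕ-cong (suc n) f≈g = trans ([]-+ _ _)
    (trans (cong₂ _⊕_ (f≈g zero) ([]-sumℕ-cong n (f≈g ∘ suc))) (sym ([]-+ _ _)))

  ⊕-comm : ∀ x y → x ⊕ y ≡ y ⊕ x
  ⊕-comm x y = cong [_] (+-comm (toℕ x) (toℕ y))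

  ⊕-assoc : ∀ x y z → (x ⊕ y) ⊕ z ≡ x ⊕ (y ⊕ z)
  ⊕-assoc x y z = begin
    (x ⊕ y) ⊕ z        ≡⟨ cong ((x ⊕ y) ⊕_) ([]-toℕ z) ⟨
    [ X + Y ] ⊕ [ Z ]  ≡⟨ []-+ (X + Y) Z ⟨
    [ X + Y + Z ]      ≡⟨ cong [_] (+-assoc X Y Z) ⟩
    [ X + (Y + Z) ]    ≡⟨ []-+ X (Y + Z) ⟩
    [ X ] ⊕ (y ⊕ z)    ≡⟨ cong (_⊕ (y ⊕ z)) ([]-toℕ x) ⟩
    x ⊕ (y ⊕ z)        ∎
    where open ≡-Reasoning
          X = toℕ x; Y = toℕ y; Z = toℕ z

  ⊕-identityʳ : ∀ x → x ⊕ 𝟘 ≡ x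
  ⊕-identityʳ x = begin
    x ⊕ 𝟘          ≡⟨ cong (_⊕ 𝟘) ([]-toℕ x) ⟨
    [ X ] ⊕ [ 0 ]  ≡⟨ []-+ X 0 ⟨
    [ X + 0 ]      ≡⟨ cong [_] (+-identityʳ X) ⟩
    [ X ]          ≡⟨ []-toℕ x ⟩
    x              ∎
    where open ≡-Reasoning
          X = toℕ x

  ⊖-inverseˡ : ∀ x → ⊖ x ⊕ x ≡ 𝟘
  ⊖-inverseˡ x = begin
    ⊖ x ⊕ x              ≡⟨ cong (⊖ x ⊕_) ([]-toℕ x) ⟨
    [ p ∸ X ] ⊕ [ X ]    ≡⟨ []-+ (p ∸ X) X ⟨
    [ p ∸ X + X ]        ≡⟨ cong [_] (m∸n+n≡m (<⇒≤ (toℕ<n x))) ⟩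
    [ p ]                ≡⟨ toℕ-injective (trans (toℕ-[] p) (trans (n%n≡0 p) (sym toℕ-𝟘))) ⟩
    [ 0 ]                ∎
    where open ≡-Reasoning
          X = toℕ x

  ⊕-isGroup : IsGroup _≡_ _⊕_ 𝟘 ⊖_
  ⊕-isGroup = record
    { isMonoid = record
      { isSemigroup = record
        { isMagma = record { isEquivalence = isEquivalence ; ∙-cong = cong₂ _⊕_ }
        ; assoc = ⊕-assoc }
      ; identity = (λ x → trans (⊕-comm 𝟘 x) (⊕-identityʳ x)) , ⊕-identityʳ }
    ; inverse = ⊖-inverseˡ , (λ x → trans (⊕-comm x (⊖ x)) (⊖-inverseˡ x))
    ; ⁻¹-cong = cong ⊖_
    }

  ⊕-group : Group 0ℓ 0ℓ
  ⊕-group = record { isGroup = ⊕-isGroup }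

  open GroupProperties ⊕-group public
    using (//-rightDividesˡ; identityʳ-unique; inverseˡ-unique; inverseʳ-unique; ⁻¹-involutive; ε⁻¹≈ε)

  toℕ-≢0 : ∀ {x} → x ≢ 𝟘 → toℕ x ≢ 0
  toℕ-≢0 x≢𝟘 toℕx≡0 = x≢𝟘 (toℕ-injective (trans toℕx≡0 (sym toℕ-𝟘)))

  ⊛-[*] : ∀ x y m → x ⊛ [ y * m ] ≡ [ y * toℕ x * m ]
  ⊛-[*] x y m = trans ([]-*-toℕ X (y * m))
                      (cong [_] (trans (sym (*-assoc X y m)) (cong (_* m) (*-comm X y))))
    where X = toℕ x

  ⊛-surjective : Prime p → ∀ {x} → x ≢ 𝟘 → ∀ z → ∃ λ t → x ⊛ t ≡ z
  ⊛-surjective p-prime {x} x≢𝟘 z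
    -- Bézout gives y with y·x ≡ 1 or y·x ≡ −1 (mod p); then t = y·z or t = y·(−z).
    with coprime-Bézout (prime⇒coprime p-prime {{≢-nonZero (toℕ-≢0 x≢𝟘)}} (toℕ<n x))
  ... | Bézout.-+ k y 1+kp≡yX = [ y * Z ] , (begin
    x ⊛ [ y * Z ]           ≡⟨ ⊛-[*] x y Z ⟩
    [ y * X * Z ]           ≡⟨ cong (λ m → [ m * Z ]) 1+kp≡yX ⟨
    [ Z + k * p * Z ]       ≡⟨ []-+-multiple Z (n∣m*n*o k Z) ⟩
    [ Z ]                   ≡⟨ []-toℕ z ⟩
    z                       ∎)
    where open ≡-Reasoning
          X = toℕ x; Z = toℕ z
  ... | Bézout.+- k y 1+yX≡kp = [ y * W ] , (begin
    x ⊛ [ y * W ]           ≡⟨ ⊛-[*] x y W ⟩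
    [ y * X * W ]           ≡⟨ inverseʳ-unique (⊖ z) _ ⊖z⊕yXW≡𝟘 ⟩
    ⊖ ⊖ z                   ≡⟨ ⁻¹-involutive z ⟩
    z                       ∎)
    where open ≡-Reasoning
          X = toℕ x; W = toℕ (⊖ z)
          ⊖z⊕yXW≡𝟘 : ⊖ z ⊕ [ y * X * W ] ≡ 𝟘
          ⊖z⊕yXW≡𝟘 = begin
            ⊖ z ⊕ [ y * X * W ]      ≡⟨ cong (_⊕ [ y * X * W ]) ([]-toℕ (⊖ z)) ⟨
            [ W ] ⊕ [ y * X * W ]    ≡⟨ []-+ W (y * X * W) ⟨
            [ (1 + y * X) * W ]      ≡⟨ cong (λ m → [ m * W ]) 1+yX≡kp ⟩
            [ 0 + k * p * W ]        ≡⟨ []-+-multiple 0 (n∣m*n*o k W) ⟩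
            𝟘                        ∎

module DotProduct (p : ℕ) .{{_ : NonZero p}} {n : ℕ} (a : Vec𝔽 p n) where
  open ModularArithmetic p

  restrict : Vec𝔽 p n → Vec𝔽 p n
  restrict x i with a i ≟ᶠ 𝟘
  ... | yes _ = 𝟘
  ... | no  _ = x i

  restrict-on-supp : ∀ x {i} → i ∈supp a → restrict x i ≡ x i
  restrict-on-supp x {i} i∈a with a i ≟ᶠ 𝟘
  ... | yes aᵢ≡𝟘 = contradiction aᵢ≡𝟘 i∈a
  ... | no  _    = refl

  supp-restrict : ∀ x i → i ∈supp restrict x → i ∈supp a
  supp-restrict x i i∈x with a i ≟ᶠ 𝟘
  ... | yes _    = contradiction refl i∈x
  ... | no  i∈a  = i∈a

  single : Fin n → 𝔽 p → Vec𝔽 p n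
  single j t = updateAt (replicate n 𝟘) j (const t)

  supp-single : ∀ {j} t → j ∈supp a → ∀ i → i ∈supp single j t → i ∈supp a
  supp-single {j} t j∈a i i∈x with i ≟ᶠ j
  ... | yes refl = j∈a
  ... | no  i≢j  = contradiction (updateAt-minimal i j _ i≢j) i∈x

  dot-cong : ∀ {x y} → (∀ i → i ∈supp a → x i ≡ y i) → dot p a x ≡ dot p a y
  dot-cong {x} {y} x≈y = cong [_] (sumℕ-cong n term-cong)
    where
    term-cong : ∀ i → toℕ (a i) * toℕ (x i) ≡ toℕ (a i) * toℕ (y i)
    term-cong i with a i ≟ᶠ 𝟘
    ... | yes aᵢ≡𝟘 = trans (annihilates (toℕ (x i))) (sym (annihilates (toℕ (y i))))
      where annihilates : ∀ m → toℕ (a i) * m ≡ 0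
            annihilates m = cong (_* m) (trans (cong toℕ aᵢ≡𝟘) toℕ-𝟘)
    ... | no  i∈a  = cong (λ u → toℕ (a i) * toℕ u) (x≈y i i∈a)

  dot-⊕ : ∀ x y → dot p a (zipWith _⊕_ x y) ≡ dot p a x ⊕ dot p a y
  dot-⊕ x y = begin
    [ sumℕ n (λ i → A i * toℕ [ X i + Y i ]) ]       ≡⟨ []-sumℕ-cong n (λ i → []-*-toℕ (A i) (X i + Y i)) ⟩
    [ sumℕ n (λ i → A i * (X i + Y i)) ]             ≡⟨ cong [_] (sumℕ-cong n (λ i → *-distribˡ-+ (A i) (X i) (Y i))) ⟩
    [ sumℕ n (λ i → A i * X i + A i * Y i) ]         ≡⟨ cong [_] (sumℕ-+ n _ _) ⟩
    [ sumℕ n (λ i → A i * X i) + sumℕ n (λ i → A i * Y i) ] ≡⟨ []-+ _ _ ⟩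
    dot p a x ⊕ dot p a y                            ∎
    where open ≡-Reasoning
          A = toℕ ∘ a; X = toℕ ∘ x; Y = toℕ ∘ y

  dot-𝟘 : dot p a (replicate n 𝟘) ≡ 𝟘
  dot-𝟘 = identityʳ-unique (dot p a 𝟘ᵥ) (dot p a 𝟘ᵥ) (begin
    dot p a 𝟘ᵥ ⊕ dot p a 𝟘ᵥ        ≡⟨ dot-⊕ 𝟘ᵥ 𝟘ᵥ ⟨
    dot p a (zipWith _⊕_ 𝟘ᵥ 𝟘ᵥ)   ≡⟨ dot-cong (λ _ _ → ⊕-identityʳ 𝟘) ⟩
    dot p a 𝟘ᵥ                     ∎)
    where open ≡-Reasoning
          𝟘ᵥ = replicate n 𝟘

  dot-⊖ : ∀ x → dot p a (map ⊖_ x) ≡ ⊖ dot p a x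
  dot-⊖ x = inverseˡ-unique (dot p a (map ⊖_ x)) (dot p a x) (begin
    dot p a (map ⊖_ x) ⊕ dot p a x        ≡⟨ dot-⊕ (map ⊖_ x) x ⟨
    dot p a (zipWith _⊕_ (map ⊖_ x) x)   ≡⟨ dot-cong (λ i _ → ⊖-inverseˡ (x i)) ⟩
    dot p a (replicate n 𝟘)              ≡⟨ dot-𝟘 ⟩
    𝟘                                    ∎)
    where open ≡-Reasoning

  dot-single : ∀ j t → dot p a (single j t) ≡ a j ⊛ t
  dot-single j t = cong [_] (trans (sumℕ-single n _ j off-j)
                                   (cong (λ u → toℕ (a j) * toℕ u) (updateAt-updates j _)))
    where
    off-j : ∀ i → i ≢ j → toℕ (a i) * toℕ (single j t i) ≡ 0
    off-j i i≢j = trans (cong (λ u → toℕ (a i) * toℕ u) (updateAt-minimal i j _ i≢j))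
                        (trans (cong (toℕ (a i) *_) toℕ-𝟘) (*-zeroʳ (toℕ (a i))))

module _ {p n : ℕ} where

  ≐-isEquivalence : IsEquivalence (_≐_ {p} {n})
  ≐-isEquivalence = record
    { refl  = λ ℓ → id , id
    ; sym   = λ C≐D ℓ → proj₂ (C≐D ℓ) , proj₁ (C≐D ℓ)
    ; trans = λ C≐D D≐E ℓ → proj₁ (D≐E ℓ) ∘ proj₁ (C≐D ℓ) , proj₂ (C≐D ℓ) ∘ proj₂ (D≐E ℓ)
    }

  ≐-setoid : Setoid (Level.suc 0ℓ) 0ℓ
  ≐-setoid = record { isEquivalence = ≐-isEquivalence }

  open Setoid ≐-setoid public using () renaming (refl to ≐-refl; sym to ≐-sym; trans to ≐-trans)

  module ≐-Reasoning = SetoidReasoning ≐-setoid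

  renClause-cong : ∀ σ {C D : Clause p n} → C ≐ D → renClause σ C ≐ renClause σ D
  renClause-cong σ C≐D ℓ = (λ (ℓ' , ℓ'∈C , eq) → ℓ' , proj₁ (C≐D ℓ') ℓ'∈C , eq)
                         , (λ (ℓ' , ℓ'∈D , eq) → ℓ' , proj₂ (C≐D ℓ') ℓ'∈D , eq)

module Clauses (p : ℕ) .{{_ : NonZero p}} {n : ℕ} (a : Vec𝔽 p n) where
  open ModularArithmetic p

  Cl-cong : ∀ {x y} → (∀ i → i ∈supp a → x i ≡ y i) → Cl p a x ≐ Cl p a y
  Cl-cong x≈y ℓ = (λ (i , i∈a , eq) → i , i∈a , trans eq (cong (λ k → neg (i , k)) (x≈y i i∈a)))
                , (λ (i , i∈a , eq) → i , i∈a , trans eq (cong (λ k → neg (i , k)) (sym (x≈y i i∈a))))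

  Cl-injective : ∀ {x y} → Cl p a x ≐ Cl p a y → ∀ i → i ∈supp a → x i ≡ y i
  Cl-injective {x} {y} Clx≐Cly i i∈a = neg-≡ (proj₂ (proj₂ (proj₁ (Clx≐Cly _) (i , i∈a , refl))))
    where
    neg-≡ : ∀ {i'} {k} → neg (i , k) ≡ neg (i' , y i') → k ≡ y i
    neg-≡ refl = refl

  renClause-Δ-Cl : ∀ x d → renClause (Δ p d) (Cl p a x) ≐ Cl p a (zipWith _⊕_ x d)
  renClause-Δ-Cl x d ℓ = (λ { (_ , (i , i∈a , refl) , refl) → i , i∈a , refl })
                       , (λ { (i , i∈a , refl) → neg (i , x i) , (i , i∈a , refl) , refl })

module Symmetry (p : ℕ) .{{_ : NonZero p}} {n : ℕ} (a : Vec𝔽 p n) (b : 𝔽 p) where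
  open ModularArithmetic p
  open DotProduct p a
  open Clauses p a

  P-restrict-shift : ∀ {s x} → dot p a s ≡ 𝟘 → P p a b x → P p a b (restrict (zipWith _⊕_ x s))
  P-restrict-shift {s} {x} a·s≡𝟘 (a·x≢b , _) = a·x≢b ∘ trans (sym a·shifted≡a·x) , supp-restrict _
    where
    a·shifted≡a·x : dot p a (restrict (zipWith _⊕_ x s)) ≡ dot p a x
    a·shifted≡a·x = begin
      dot p a (restrict (zipWith _⊕_ x s))  ≡⟨ dot-cong (λ _ → restrict-on-supp _) ⟩
      dot p a (zipWith _⊕_ x s)             ≡⟨ dot-⊕ x s ⟩
      dot p a x ⊕ dot p a s                 ≡⟨ cong (dot p a x ⊕_) a·s≡𝟘 ⟩
      dot p a x ⊕ 𝟘                         ≡⟨ ⊕-identityʳ _ ⟩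
      dot p a x                             ∎
      where open ≡-Reasoning

  orthogonal⇒Δ-symmetric : ∀ {d} → dot p a d ≡ 𝟘 → Δ p d ∈Sym Fab p a b
  orthogonal⇒Δ-symmetric {d} a·d≡𝟘 C = image⊆F , F⊆image
    where
    open ≐-Reasoning

    image⊆F : renFormula (Δ p d) (Fab p a b) C → Fab p a b C
    image⊆F (C' , lift (x , x∈P , C'≐Clx) , ΔC'≐C) =
      lift (restrict (zipWith _⊕_ x d) , P-restrict-shift a·d≡𝟘 x∈P , (begin
        C                                    ≈⟨ ≐-sym ΔC'≐C ⟩
        renClause (Δ p d) C'                 ≈⟨ renClause-cong (Δ p d) C'≐Clx ⟩
        renClause (Δ p d) (Cl p a x)         ≈⟨ renClause-Δ-Cl x d ⟩
        Cl p a (zipWith _⊕_ x d)             ≈⟨ Cl-cong (λ _ i∈a → sym (restrict-on-supp _ i∈a)) ⟩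
        Cl p a (restrict (zipWith _⊕_ x d))  ∎))

    F⊆image : Fab p a b C → renFormula (Δ p d) (Fab p a b) C
    F⊆image (lift (x , x∈P , C≐Clx)) = Cl p a z , lift (z , P-restrict-shift a·⊖d≡𝟘 x∈P , ≐-refl) , (begin
      renClause (Δ p d) (Cl p a z)  ≈⟨ renClause-Δ-Cl z d ⟩
      Cl p a (zipWith _⊕_ z d)      ≈⟨ Cl-cong z⊕d≈x ⟩
      Cl p a x                      ≈⟨ ≐-sym C≐Clx ⟩
      C                             ∎)
      where
      z = restrict (zipWith _⊕_ x (map ⊖_ d))
      a·⊖d≡𝟘 : dot p a (map ⊖_ d) ≡ 𝟘
      a·⊖d≡𝟘 = trans (dot-⊖ d) (trans (cong ⊖_ a·d≡𝟘) ε⁻¹≈ε)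
      z⊕d≈x : ∀ i → i ∈supp a → z i ⊕ d i ≡ x i
      z⊕d≈x i i∈a = trans (cong (_⊕ d i) (restrict-on-supp _ i∈a)) (//-rightDividesˡ (d i) (x i))

  ∃-P-shifted-to-b : Prime p → ∀ {j d} → j ∈supp a → dot p a d ≢ 𝟘
                   → ∃ λ x → P p a b x × dot p a (zipWith _⊕_ x d) ≡ b
  ∃-P-shifted-to-b p-prime {j} {d} j∈a c≢𝟘 = x , (a·x≢b , supp-single t j∈a) , (begin
    dot p a (zipWith _⊕_ x d)  ≡⟨ dot-⊕ x d ⟩
    dot p a x ⊕ c              ≡⟨ cong (_⊕ c) a·x≡b⊖c ⟩
    b ⊕ ⊖ c ⊕ c                ≡⟨ //-rightDividesˡ c b ⟩
    b                          ∎)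
    where
    open ≡-Reasoning
    c = dot p a d
    solution = ⊛-surjective p-prime j∈a (b ⊕ ⊖ c)
    t = proj₁ solution
    x = single j t
    a·x≡b⊖c : dot p a x ≡ b ⊕ ⊖ c
    a·x≡b⊖c = trans (dot-single j t) (proj₂ solution)
    a·x≢b : dot p a x ≢ b
    a·x≢b a·x≡b = c≢𝟘 (identityʳ-unique b c (begin
      b ⊕ c        ≡⟨ cong (_⊕ c) (trans (sym a·x≡b) a·x≡b⊖c) ⟩
      b ⊕ ⊖ c ⊕ c  ≡⟨ //-rightDividesˡ c b ⟩
      b            ∎))

  ¬orthogonal⇒¬Δ-symmetric : Prime p → ∀ {j d} → j ∈supp a → dot p a d ≢ 𝟘 → ¬ Δ p d ∈Sym Fab p a b
  ¬orthogonal⇒¬Δ-symmetric p-prime {d = d} j∈a c≢𝟘 Δ-sym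
    with x , x∈P , a·[x⊕d]≡b ← ∃-P-shifted-to-b p-prime j∈a c≢𝟘
    with lift (y , (a·y≢b , _) , ΔClx≐Cly) ← proj₁ (Δ-sym _) (Cl p a x , lift (x , x∈P , ≐-refl) , ≐-refl)
    = a·y≢b (trans (sym (dot-cong (Cl-injective (≐-trans (≐-sym (renClause-Δ-Cl x d)) ΔClx≐Cly)))) a·[x⊕d]≡b)

  Δ-symmetric⇒orthogonal : Prime p → ∀ {d} → Δ p d ∈Sym Fab p a b → dot p a d ≡ 𝟘
  Δ-symmetric⇒orthogonal p-prime {d} Δ-sym with any? (λ i → ¬? (a i ≟ᶠ 𝟘))
  ... | yes (j , j∈a) = decidable-stable (dot p a d ≟ᶠ 𝟘) (λ c≢𝟘 → ¬orthogonal⇒¬Δ-symmetric p-prime j∈a c≢𝟘 Δ-sym)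
  ... | no  ∄j∈a      = trans (dot-cong (λ i i∈a → contradiction (i , i∈a) ∄j∈a)) dot-𝟘

lemma4p3 : (p : ℕ) .{{_ : NonZero p}} → Prime p → (n : ℕ)
           → (a d : Vec𝔽 p n) (b : 𝔽 p)
           → Δ p d ∈Sym Fab p a b ⇔ (dot p a d ≡ zeroₚ p)
lemma4p3 p p-prime n a d b = mk⇔ (Δ-symmetric⇒orthogonal p-prime) orthogonal⇒Δ-symmetric
  where open Symmetry p a b
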